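{- Let $n\ge2$ and let $S_n^B=\{\pi\in\mathrm{Sym}([\pm n])\mid \pi(-i)=-\pi(i)\ \forall i\}$ be the group of signed permutations. For each $j\in\{2,\dots,n\}$ choose $i_j\in\{1,\dots,j-1\}$, and let $R'=\{(2,i_2)(-2,-i_2),\dots,(n,i_n)(-n,-i_n)\}\subseteq S_n^B$. Then the graph with vertex set $R'$, in which two distinct elements are joined by an edge iff they do not commute, is (isomorphic to) a Carter diagram of type $A_{n-1}$.
   Context: $S_n^B$ realizes the Weyl group of type $B_n$; its reflections are $(i,j)(-i,-j)$ for $1\le i<|j|\le n$ and $(i,-i)$ for $i\in[n]$. A Carter diagram of type $A_{n-1}$ is, equivalently, the graph on $n-1$ transpositions generating $\mathrm{Sym}([n])$, with edges joining non-commuting transpositions (the Carter diagram of the corresponding linearly independent roots of a root system of type $A_{n-1}$). -}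

module Defs where

open import Data.Nat using (ℕ; _≤_; _<_; _∸_)
open import Data.Fin using (Fin; toℕ; _≟_)
open import Data.Fin.Permutation using (Permutation′; transpose; _∘ₚ_; _≈_; id)
open import Data.Bool using (Bool; not)
open import Data.Product using (_×_; _,_; Σ; Σ-syntax; ∃-syntax)
open import Data.List using (List; foldr)
open import Relation.Nullary using (¬_; yes; no)
open import Relation.Binary.PropositionalEquality using (_≡_; _≢_; refl)
open import Function.Bundles using (_↔_; Inverse; _⇔_)
open import Function.Properties.Inverse using (↔-refl)
open import Data.Product.Function.NonDependent.Propositional using (_×-↔_)

-- Signed permutations S_n^B.
-- The set [±n] = {±1,…,±n} is modelled as Fin n × Bool:
-- (i , false) is +(i+1), (i , true) is -(i+1).

SignedPt : ℕ → Set
SignedPt n = Fin n × Bool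

neg : ∀ {n} → SignedPt n → SignedPt n
neg (i , s) = (i , not s)

record SignedPerm (n : ℕ) : Set where
  field
    perm   : SignedPt n ↔ SignedPt n
    oddity : ∀ x → Inverse.to perm (neg x) ≡ neg (Inverse.to perm x)

app : ∀ {n} → SignedPerm n → SignedPt n → SignedPt n
app π = Inverse.to (SignedPerm.perm π)

CommuteB : ∀ {n} → SignedPerm n → SignedPerm n → Set
CommuteB π ρ = ∀ x → app π (app ρ x) ≡ app ρ (app π x)

liftB : ∀ {n} → Permutation′ n → SignedPerm n
liftB π = record { perm = π ×-↔ ↔-refl ; oddity = λ _ → refl }

signedTransp : ∀ {n} → Fin n → Fin n → SignedPerm n
signedTransp a b = liftB (transpose a b)

-- Index set {2,…,n} of R' (0-based: j with toℕ j ≥ 1), and the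
-- element (j, i_j)(-j, -i_j) of R' for a choice function i.
Idx : ℕ → Set
Idx n = Σ[ j ∈ Fin n ] 1 ≤ toℕ j

RElem : ∀ {n} → ((j : Fin n) → 1 ≤ toℕ j → Fin n) → Idx n → SignedPerm n
RElem i (j , h) = signedTransp j (i j h)

CommuteA : ∀ {n} → Permutation′ n → Permutation′ n → Set
CommuteA π ρ = (π ∘ₚ ρ) ≈ (ρ ∘ₚ π)

prodT : ∀ {n k} → (Fin k → Fin n × Fin n) → List (Fin k) → Permutation′ n
prodT t = foldr (λ w π → tr (t w) ∘ₚ π) id
  where
    tr : _ → _
    tr (a , b) = transpose a b

record CarterA (n : ℕ) : Set where
  field
    t        : Fin (n ∸ 1) → Fin n × Fin n
    isTransp : ∀ v → Data.Product.proj₁ (t v) ≢ Data.Product.proj₂ (t v)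
    distinct : ∀ u v → u ≢ v →
                 ¬ (transpose (Data.Product.proj₁ (t u)) (Data.Product.proj₂ (t u))
                     ≈ transpose (Data.Product.proj₁ (t v)) (Data.Product.proj₂ (t v)))
    generate : ∀ (π : Permutation′ n) → ∃[ ws ] (π ≈ prodT t ws)

  transp : Fin (n ∸ 1) → Permutation′ n
  transp v = transpose (Data.Product.proj₁ (t v)) (Data.Product.proj₂ (t v))

  Edge : Fin (n ∸ 1) → Fin (n ∸ 1) → Set
  Edge u v = ¬ CommuteA (transp u) (transp v)

-- The vertex j ∈ {2,…,n} of R' is the lift of the transposition (j, i_j) of [n], and lifting
-- preserves and reflects commutation, so R' has the same commutation graph as these n-1
-- transpositions. Since i_j < j, the pairs {j, i_j} are the edges of a spanning tree of [n];
-- transpositions along the edges of a connected graph generate Sym([n]), because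
-- (a p)(p b)(a p) = (a b) makes "the transposition (a b) is generated" transitive in a and b.
-- They are pairwise distinct because (j, i_j) moves j while every (j', i_{j'}) with j' < j fixes it.
module Submission where

open import Defs
open import Data.Nat using (ℕ; suc; _≤_; _<_; _∸_; s≤s; z≤n)
open import Data.Nat.Properties using (<-irrefl; <-trans; <-cmp)
open import Data.Fin using (Fin; toℕ; _≟_) renaming (zero to fzero; suc to fsuc; _<_ to _<ᶠ_)
open import Data.Fin.Properties using (toℕ-injective)
open import Data.Fin.Induction using (<-wellFounded)
open import Data.Fin.Permutation using (Permutation′; transpose; _∘ₚ_; _≈_; id; _⟨$⟩ʳ_)
import Data.Fin.Permutation.Components as PC
open import Data.Fin.Permutation.Transposition.List using (TranspositionList; eval; decompose; eval-decompose)
open import Data.Bool using (false)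
open import Data.Product using (Σ; Σ-syntax; _×_; _,_; proj₁; proj₂)
open import Data.List using (List; []; _∷_; _++_)
open import Function using (_∘_)
open import Function.Bundles using (_↔_; _⇔_; Inverse; mk⇔; mk↔ₛ′)
open import Function.Related.TypeIsomorphisms using (¬-cong-⇔)
open import Induction.WellFounded using (Acc; acc)
open import Relation.Binary using (tri<; tri≈; tri>)
open import Relation.Binary.PropositionalEquality using (_≡_; _≢_; refl; sym; trans; cong; module ≡-Reasoning)
open import Relation.Nullary using (¬_; Dec; yes; no)
open import Relation.Nullary.Decidable using (dec-true; dec-false)

transpose-applyˡ : ∀ {n} (a b : Fin n) → PC.transpose a b a ≡ b
transpose-applyˡ a b rewrite dec-true (a ≟ a) refl = refl

transpose-applyʳ : ∀ {n} (a b : Fin n) → PC.transpose a b b ≡ a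
transpose-applyʳ a b with b ≟ a
... | yes refl = refl
... | no _ rewrite dec-true (b ≟ b) refl = refl

transpose-apply-other : ∀ {n} (a b k : Fin n) → k ≢ a → k ≢ b → PC.transpose a b k ≡ k
transpose-apply-other a b k k≢a k≢b rewrite dec-false (k ≟ a) k≢a | dec-false (k ≟ b) k≢b = refl

transpose-comm : ∀ {n} (a b : Fin n) → transpose a b ≈ transpose b a
transpose-comm a b k = cases (k ≟ a) (k ≟ b)
  where
  cases : Dec (k ≡ a) → Dec (k ≡ b) → PC.transpose a b k ≡ PC.transpose b a k
  cases (yes refl) _          = trans (transpose-applyˡ k b) (sym (transpose-applyʳ b k))
  cases (no _)     (yes refl) = trans (transpose-applyʳ a k) (sym (transpose-applyˡ k a))
  cases (no k≢a)   (no k≢b)   = trans (transpose-apply-other a b k k≢a k≢b)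
                                      (sym (transpose-apply-other b a k k≢b k≢a))

transpose-self : ∀ {n} (a : Fin n) → transpose a a ≈ id
transpose-self a k with k ≟ a
... | yes refl = refl
... | no k≢a rewrite dec-false (k ≟ a) k≢a = refl

transpose-conjugate : ∀ {n} {a p b : Fin n} → a ≢ p → p ≢ b → a ≢ b →
                      (transpose a p ∘ₚ transpose p b ∘ₚ transpose a p) ≈ transpose a b
transpose-conjugate {a = a} {p} {b} a≢p p≢b a≢b k = cases (k ≟ a) (k ≟ p) (k ≟ b)
  where
  cases : Dec (k ≡ a) → Dec (k ≡ p) → Dec (k ≡ b) →
          PC.transpose a p (PC.transpose p b (PC.transpose a p k)) ≡ PC.transpose a b k
  cases (yes refl) _ _
    rewrite transpose-applyˡ k p | transpose-applyˡ p b
          | transpose-apply-other k p b (a≢b ∘ sym) (p≢b ∘ sym) = sym (transpose-applyˡ k b)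
  cases (no _) (yes refl) _
    rewrite transpose-applyʳ a k | transpose-apply-other k b a a≢p a≢b
          | transpose-applyˡ a k = sym (transpose-apply-other a b k (a≢p ∘ sym) p≢b)
  cases (no k≢a) (no k≢p) (yes refl)
    rewrite transpose-apply-other a p k k≢a k≢p | transpose-applyʳ p k
          | transpose-applyʳ a p | transpose-applyʳ a k = refl
  cases (no k≢a) (no k≢p) (no k≢b)
    rewrite transpose-apply-other a p k k≢a k≢p | transpose-apply-other p b k k≢p k≢b
          | transpose-apply-other a p k k≢a k≢p = sym (transpose-apply-other a b k k≢a k≢b)

transpose-moves-≉ : ∀ {n} {a b c d : Fin n} → a ≢ b → a ≢ c → a ≢ d →
                    ¬ (transpose a b ≈ transpose c d)
transpose-moves-≉ {a = a} {b} {c} {d} a≢b a≢c a≢d eq = a≢b (begin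
  a                   ≡⟨ sym (transpose-apply-other c d a a≢c a≢d) ⟩
  PC.transpose c d a  ≡⟨ sym (eq a) ⟩
  PC.transpose a b a  ≡⟨ transpose-applyˡ a b ⟩
  b                   ∎)
  where open ≡-Reasoning

liftB-commute⇔ : ∀ {n} (π ρ : Permutation′ n) → CommuteB (liftB π) (liftB ρ) ⇔ CommuteA π ρ
liftB-commute⇔ π ρ = mk⇔ (λ comm k → sym (cong proj₁ (comm (k , false))))
                         (λ comm (k , s) → cong (_, s) (sym (comm k)))

module Generation {n k : ℕ} (t : Fin k → Fin n × Fin n) where

  record Generated (π : Permutation′ n) : Set where
    constructor _,_
    field
      word  : List (Fin k)
      spelt : π ≈ prodT t word

  prodT-++ : ∀ ws vs → prodT t (ws ++ vs) ≈ (prodT t ws ∘ₚ prodT t vs)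
  prodT-++ []       vs x = refl
  prodT-++ (w ∷ ws) vs x = prodT-++ ws vs _

  generated-id : Generated id
  generated-id = [] , λ _ → refl

  generated-∘ : ∀ {π ρ} → Generated π → Generated ρ → Generated (π ∘ₚ ρ)
  generated-∘ {π} {ρ} (ws , π≈) (vs , ρ≈) = ws ++ vs , λ x →
    trans (cong (ρ ⟨$⟩ʳ_) (π≈ x)) (trans (ρ≈ _) (sym (prodT-++ ws vs x)))

  generated-resp-≈ : ∀ {π ρ} → π ≈ ρ → Generated ρ → Generated π
  generated-resp-≈ π≈ρ (ws , ρ≈) = ws , λ x → trans (π≈ρ x) (ρ≈ x)

  generated-generator : ∀ w → Generated (transpose (proj₁ (t w)) (proj₂ (t w)))
  generated-generator w = w ∷ [] , λ _ → refl

  Linked : Fin n → Fin n → Set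
  Linked a b = Generated (transpose a b)

  linked-refl : ∀ a → Linked a a
  linked-refl a = generated-resp-≈ (transpose-self a) generated-id

  linked-sym : ∀ {a b} → Linked a b → Linked b a
  linked-sym {a} {b} = generated-resp-≈ (transpose-comm b a)

  linked-trans : ∀ {a p b} → Linked a p → Linked p b → Linked a b
  linked-trans {a} {p} {b} ap pb with a ≟ p | p ≟ b | a ≟ b
  ... | yes refl | _        | _        = pb
  ... | no _     | yes refl | _        = ap
  ... | no _     | no _     | yes refl = linked-refl a
  ... | no a≢p   | no p≢b   | no a≢b   =
    generated-resp-≈ (λ x → sym (transpose-conjugate a≢p p≢b a≢b x))
                     (generated-∘ ap (generated-∘ pb ap))

  generated-all : (∀ a b → Linked a b) → ∀ π → Generated π
  generated-all linked π = generated-resp-≈ (λ x → sym (eval-decompose π x)) (generated-eval (decompose π))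
    where
    generated-eval : (xs : TranspositionList n) → Generated (eval xs)
    generated-eval []             = generated-id
    generated-eval ((a , b) ∷ xs) = generated-∘ (linked a b) (generated-eval xs)

module DescendingTree {m : ℕ} (i : (j : Fin (suc m)) → 1 ≤ toℕ j → Fin (suc m))
                      (i<j : ∀ j h → toℕ (i j h) < toℕ j) where

  parent : Fin m → Fin (suc m)
  parent v = i (fsuc v) (s≤s z≤n)

  parent< : ∀ v → toℕ (parent v) < suc (toℕ v)
  parent< v = i<j (fsuc v) (s≤s z≤n)

  edge : Fin m → Fin (suc m) × Fin (suc m)
  edge v = fsuc v , parent v

  open Generation edge

  linked-root : ∀ j → Acc _<ᶠ_ j → Linked j fzero
  linked-root fzero    _        = linked-refl fzero
  linked-root (fsuc v) (acc rs) =
    linked-trans (generated-generator v) (linked-root (parent v) (rs (parent< v)))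

  linked : ∀ a b → Linked a b
  linked a b = linked-trans (linked-root a (<-wellFounded a)) (linked-sym (linked-root b (<-wellFounded b)))

  parent≢ : ∀ v → fsuc v ≢ parent v
  parent≢ v eq = <-irrefl (cong toℕ (sym eq)) (parent< v)

  edge-distinct< : ∀ {u v} → toℕ v < toℕ u →
                   ¬ (transpose (fsuc u) (parent u) ≈ transpose (fsuc v) (parent v))
  edge-distinct< {u} {v} v<u = transpose-moves-≉ (parent≢ u)
    (λ eq → <-irrefl (cong toℕ (sym eq)) (s≤s v<u))
    (λ eq → <-irrefl (cong toℕ (sym eq)) (<-trans (parent< v) (s≤s v<u)))

  edge-distinct : ∀ u v → u ≢ v →
                  ¬ (transpose (fsuc u) (parent u) ≈ transpose (fsuc v) (parent v))
  edge-distinct u v u≢v eq with <-cmp (toℕ u) (toℕ v)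
  ... | tri< u<v _ _ = edge-distinct< u<v (λ x → sym (eq x))
  ... | tri≈ _ u≡v _ = u≢v (toℕ-injective u≡v)
  ... | tri> _ _ v<u = edge-distinct< v<u eq

  carter : CarterA (suc m)
  carter = record
    { t        = edge
    ; isTransp = parent≢
    ; distinct = edge-distinct
    ; generate = λ π → let (ws , spelt) = generated-all linked π in ws , spelt
    }

idx↔pred : ∀ {m} → Idx (suc m) ↔ Fin m
idx↔pred = mk↔ₛ′ (λ { (fzero , ()) ; (fsuc v , _) → v }) (λ v → fsuc v , s≤s z≤n)
                 (λ _ → refl) (λ { (fsuc v , s≤s z≤n) → refl })

proposition2p19 : (n : ℕ) → 2 ≤ n →
    (i : (j : Fin n) → 1 ≤ toℕ j → Fin n) →
    (∀ j h → toℕ (i j h) < toℕ j) →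
    Σ[ C ∈ CarterA n ] Σ[ φ ∈ (Idx n ↔ Fin (n ∸ 1)) ]
      (∀ u v → u ≢ v →
        ((¬ CommuteB (RElem i u) (RElem i v))
          ⇔ CarterA.Edge C (Inverse.to φ u) (Inverse.to φ v)))
proposition2p19 (suc m) _ i i<j = DescendingTree.carter i i<j , idx↔pred , edges-agree
  where
  edges-agree : ∀ u v → u ≢ v →
    (¬ CommuteB (RElem i u) (RElem i v)) ⇔
      CarterA.Edge (DescendingTree.carter i i<j) (Inverse.to idx↔pred u) (Inverse.to idx↔pred v)
  edges-agree (fsuc a , s≤s z≤n) (fsuc b , s≤s z≤n) _ =
    ¬-cong-⇔ (liftB-commute⇔ (transpose (fsuc a) (i (fsuc a) (s≤s z≤n)))
                             (transpose (fsuc b) (i (fsuc b) (s≤s z≤n))))
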